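{- There exist a strictly increasing sequence $(m_n)_{n\in\mathbb N}$ of natural numbers with $m_0 = 0$, finite groups $G_n$, group homomorphisms $c_n\colon \mathbb F({}^n 2) \to G_n$, and actions $\sigma_n$ of $G_n$ on $I_n := \{k \in \mathbb N : m_n \leq k < m_{n+1}\}$ which are faithful and transitive, such that for all $n \in \mathbb N$: (A) $\sum_{m<n} |I_m| < |I_n| - 1$, and (B) the restriction $c_n \restriction W_n$ is injective.
   Context: For a set $X$, $\mathbb F(X)$ is the free group on the generating set $X$. ${}^n2$ is the set of $0$–$1$ sequences of length $n$ (so $\mathbb F({}^0 2)$ is the trivial group). $W_n$ denotes the set of reduced words of $\mathbb F({}^n 2)$ of length at most $n$. -}

module Defs where

open import Level using (0ℓ)
open import Data.Nat using (ℕ; zero; suc; _≤_; _<_; _∸_)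
open import Data.Bool using (Bool; true; false; not)
import Data.Bool.Properties as BoolP
open import Data.Vec using (Vec)
import Data.Vec.Properties as VecP
open import Data.List using (List; []; _∷_; _++_; foldr; length; map; upTo)
open import Data.Nat.ListAction using (sum)
open import Data.Product using (Σ; ∃; _×_; _,_; proj₁)
open import Data.Unit using (⊤)
open import Relation.Nullary using (¬_; yes; no; Dec)
open import Relation.Binary.PropositionalEquality using (_≡_)
open import Algebra.Bundles using (Group)

Seq2 : ℕ → Set
Seq2 n = Vec Bool n

-- A letter of the free group on X: a generator with a sign
-- (true = x, false = x⁻¹).
Letter : ℕ → Set
Letter n = Seq2 n × Bool

Word : ℕ → Set
Word n = List (Letter n)

Cancels : ∀ {n} → Letter n → Letter n → Set
Cancels (x , b) (y , c) = (x ≡ y) × (c ≡ not b)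

cancels? : ∀ {n} (a b : Letter n) → Dec (Cancels a b)
cancels? (x , b) (y , c) with VecP.≡-dec BoolP._≟_ x y | c BoolP.≟ not b
... | yes p | yes q = yes (p , q)
... | no ¬p | _ = no (λ { (p , _) → ¬p p })
... | yes _ | no ¬q = no (λ { (_ , q) → ¬q q })

Reduced : ∀ {n} → Word n → Set
Reduced [] = ⊤
Reduced (a ∷ []) = ⊤
Reduced (a ∷ b ∷ w) = ¬ Cancels a b × Reduced (b ∷ w)

push : ∀ {n} → Letter n → Word n → Word n
push a [] = a ∷ []
push a (b ∷ w) with cancels? a b
... | yes _ = w
... | no _ = a ∷ b ∷ w

reduce : ∀ {n} → Word n → Word n
reduce = foldr push []

-- The free group 𝔽(ⁿ2) is the set of reduced words with product
-- u · v = reduce (u ++ v).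
IsFreeGroupHom : ∀ n (G : Group 0ℓ 0ℓ) → (Word n → Group.Carrier G) → Set
IsFreeGroupHom n G c = ∀ u v → Reduced u → Reduced v →
  c (reduce (u ++ v)) ≈ (c u ∙ c v)
  where open Group G

InW : ∀ n → Word n → Set
InW n w = Reduced w × length w ≤ n

InjectiveOnW : ∀ n (G : Group 0ℓ 0ℓ) → (Word n → Group.Carrier G) → Set
InjectiveOnW n G c = ∀ u v → InW n u → InW n v → c u ≈ c v → u ≡ v
  where open Group G

IsFiniteGroup : Group 0ℓ 0ℓ → Set
IsFiniteGroup G = ∃ λ (xs : List Carrier) → ∀ g → Data.List.Relation.Unary.Any.Any (g ≈_) xs
  where open Group G
        import Data.List.Relation.Unary.Any

Interval : (ℕ → ℕ) → ℕ → Set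
Interval m n = Σ ℕ λ k → (m n ≤ k) × (k < m (suc n))

record IsAction (G : Group 0ℓ 0ℓ) (S : Set) (_≈S_ : S → S → Set)
                (act : Group.Carrier G → S → S) : Set where
  open Group G
  field
    act-cong  : ∀ {g h} x → g ≈ h → act g x ≈S act h x
    act-ident : ∀ x → act ε x ≈S x
    act-comp  : ∀ g h x → act (g ∙ h) x ≈S act g (act h x)
    faithful   : ∀ g → (∀ x → act g x ≈S x) → g ≈ ε
    transitive : ∀ x y → ∃ λ g → act g x ≈S y

EqI : ∀ m n → Interval m n → Interval m n → Set
EqI m n x y = proj₁ x ≡ proj₁ y

StrictlyIncreasing : (ℕ → ℕ) → Set
StrictlyIncreasing m = ∀ n → m n < m (suc n)

size : (ℕ → ℕ) → ℕ → ℕ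
size m j = m (suc j) ∸ m j

sumSizes : (ℕ → ℕ) → ℕ → ℕ
sumSizes m n = sum (map (size m) (upTo n))

module Submission where

open import Defs
open import Level using (0ℓ)
open import Data.Bool using (true; false; not; if_then_else_)
open import Data.Bool.Properties using (not-involutive; not-injective)
import Data.Bool.Properties as Bool
open import Data.Fin using (Fin; zero; suc; toℕ; fromℕ<; finToFun; funToFin; splitAt; _↑ʳ_)
open import Data.Fin.Properties
  using (_≟_; all?; finToFun-funToFin; toℕ-fromℕ<; toℕ-injective; toℕ<n; splitAt-↑ʳ; 1↔⊤; 2↔Bool; +↔⊎; *↔×)
open import Data.Fin.Permutation using (Permutation′; permutation; transpose; _⟨$⟩ʳ_; _⟨$⟩ˡ_; inverseˡ; inverseʳ)
open import Data.List using (List; []; _∷_; _++_; _∷ʳ_; length; map; foldr; concat; allFin; upTo; cartesianProductWith)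
open import Data.List.Properties using (length-map; map-++; applyUpTo-∷ʳ)
open import Data.List.Relation.Unary.Any using (Any; here)
import Data.List.Relation.Unary.Any as Any
open import Data.List.Relation.Unary.Any.Properties using (map⁺; concat⁺; cartesianProductWith⁺)
open import Data.List.Membership.Propositional.Properties using (∈-allFin)
open import Data.Nat using (ℕ; zero; suc; _+_; _*_; _^_; _∸_; _≤_; _<_; _≤?_; s≤s; z≤n)
open import Data.Nat.ListAction using (sum)
open import Data.Nat.ListAction.Properties using (sum-++)
open import Data.Nat.Properties
  using (≤-trans; n≤1+n; m≤m+n; m<m+n; m+n∸m≡n; m+[n∸m]≡n; +-identityʳ; +-cancelˡ-≡; +-monoʳ-<; ∸-monoˡ-<)
open import Data.Product using (Σ; _×_; _,_; proj₁; proj₂; uncurry)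
open import Data.Product.Function.NonDependent.Propositional using (_×-↔_)
open import Data.Sum using (_⊎_; inj₁; inj₂; [_,_]′)
open import Data.Sum.Function.Propositional using (_⊎-↔_)
open import Data.Unit using (⊤; tt)
open import Data.Vec using (Vec; []; _∷_; uncons)
import Data.Vec.Properties as Vec
open import Function using (_∘_; const)
open import Function.Bundles using (_↔_; mk↔ₛ′; Inverse)
open import Function.Construct.Composition using (_↔-∘_)
open import Function.Construct.Identity using (↔-id)
open import Function.Construct.Symmetry using (↔-sym)
open import Relation.Binary.Definitions using (DecidableEquality)
open import Relation.Binary.PropositionalEquality
  using (_≡_; refl; sym; trans; cong; cong₂; subst; subst₂; _≗_; module ≡-Reasoning)
open import Relation.Nullary using (¬_; yes; no; does)
open import Relation.Nullary.Decidable using (dec-true; _×-dec_)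
open import Relation.Nullary.Negation using (contradiction)
open import Relation.Unary using (Pred; Decidable)
open import Algebra.Bundles using (Group)

-- The free group 𝔽(ⁿ2) acts on the ball Bₙ of reduced words of length at most n:
-- a letter a sends w to the reduced product a·w when that stays in the ball, and
-- otherwise (a·w = a ∷ w has length n + 1) it inverts every occurrence of the
-- generator of a in w.  Each letter acts by a permutation of Bₙ whose inverse is the
-- action of the inverse letter, so this is a homomorphism 𝔽(ⁿ2) → Sym(Bₙ), and a word
-- w ∈ Wₙ sends the empty word to w, so it is injective on Wₙ.  Coding Bₙ into
-- {0, …, Kₙ - 1}, with mₙ + 2 extra points fixed by everything, gives finite groups
-- Sym(Kₙ) acting faithfully and transitively on Iₙ when mₙ₊₁ = mₙ + Kₙ; the padding
-- makes ∑_{j<n} |I_j| = mₙ < |Iₙ| - 1.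

module _ {n : ℕ} where

  invert : Letter n → Letter n
  invert (x , b) = x , not b

  invert-involutive : ∀ a → invert (invert a) ≡ a
  invert-involutive (x , b) = cong (x ,_) (not-involutive b)

  cancels⇒≡invert : ∀ {a b : Letter n} → Cancels a b → b ≡ invert a
  cancels⇒≡invert (refl , refl) = refl

  invert-cancels : ∀ a → Cancels (invert a) a
  invert-cancels (x , b) = refl , sym (not-involutive b)

  push-cancels : ∀ {a b : Letter n} w → Cancels a b → push a (b ∷ w) ≡ w
  push-cancels {a} {b} w c with cancels? a b
  ... | yes _ = refl
  ... | no ¬c = contradiction c ¬c

  push-keeps : ∀ {a b : Letter n} w → ¬ Cancels a b → push a (b ∷ w) ≡ a ∷ b ∷ w
  push-keeps {a} {b} w ¬c with cancels? a b
  ... | yes c = contradiction c ¬c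
  ... | no _  = refl

  Reduced-tail : ∀ {a : Letter n} w → Reduced (a ∷ w) → Reduced w
  Reduced-tail []      _       = tt
  Reduced-tail (_ ∷ _) (_ , r) = r

  reduced? : Decidable (Reduced {n})
  reduced? []          = yes tt
  reduced? (a ∷ [])    = yes tt
  reduced? (a ∷ b ∷ w) with cancels? a b | reduced? (b ∷ w)
  ... | no ¬c | yes r  = yes (¬c , r)
  ... | yes c | _      = no (λ r → proj₁ r c)
  ... | no _  | no ¬r  = no (¬r ∘ proj₂)

  Reduced-push : ∀ a w → Reduced w → Reduced (push a w)
  Reduced-push a []      _ = tt
  Reduced-push a (b ∷ w) r with cancels? a b
  ... | yes _ = Reduced-tail w r
  ... | no ¬c = ¬c , r

  push-reduced : ∀ a w → Reduced (a ∷ w) → push a w ≡ a ∷ w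
  push-reduced a []      _        = refl
  push-reduced a (b ∷ w) (¬c , _) = push-keeps w ¬c

  push-invert : ∀ a w → Reduced w → push (invert a) (push a w) ≡ w
  push-invert a []      _ = push-cancels [] (invert-cancels a)
  push-invert a (b ∷ w) r with cancels? a b
  ... | no _  = push-cancels (b ∷ w) (invert-cancels a)
  ... | yes c rewrite cancels⇒≡invert c = push-reduced (invert a) w r

module Evaluation (G : Group 0ℓ 0ℓ) where

  open Group G using (Carrier; _≈_; _∙_; ε; setoid; identityˡ; assoc; ∙-congˡ; ∙-congʳ)
    renaming (refl to ≈-refl; sym to ≈-sym; trans to ≈-trans)
  open import Relation.Binary.Reasoning.Setoid setoid

  module _ {n : ℕ} (f : Letter n → Carrier) (f-invert : ∀ a → f a ∙ f (invert a) ≈ ε) where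

    eval : Word n → Carrier
    eval = foldr (λ a g → f a ∙ g) ε

    eval-push : ∀ a w → eval (push a w) ≈ f a ∙ eval w
    eval-push a []      = ≈-refl
    eval-push a (b ∷ w) with cancels? a b
    ... | no _  = ≈-refl
    ... | yes c rewrite cancels⇒≡invert c = begin
      eval w                        ≈⟨ identityˡ (eval w) ⟨
      ε ∙ eval w                    ≈⟨ ∙-congʳ (f-invert a) ⟨
      (f a ∙ f (invert a)) ∙ eval w ≈⟨ assoc (f a) (f (invert a)) (eval w) ⟩
      f a ∙ (f (invert a) ∙ eval w) ∎

    eval-reduce : ∀ w → eval (reduce w) ≈ eval w
    eval-reduce []      = ≈-refl
    eval-reduce (a ∷ w) = ≈-trans (eval-push a (reduce w)) (∙-congˡ (eval-reduce w))

    eval-++ : ∀ u v → eval (u ++ v) ≈ eval u ∙ eval v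
    eval-++ []      v = ≈-sym (identityˡ (eval v))
    eval-++ (a ∷ u) v = ≈-trans (∙-congˡ (eval-++ u v)) (≈-sym (assoc (f a) (eval u) (eval v)))

    eval-isFreeGroupHom : IsFreeGroupHom n G eval
    eval-isFreeGroupHom u v _ _ = ≈-trans (eval-reduce (u ++ v)) (eval-++ u v)

module _ {n : ℕ} where

  _≟ˢ_ : DecidableEquality (Seq2 n)
  _≟ˢ_ = Vec.≡-dec Bool._≟_

  signFlip : Seq2 n → Letter n → Letter n
  signFlip x (y , b) = y , (if does (x ≟ˢ y) then not b else b)

  signFlip-involutive : ∀ x a → signFlip x (signFlip x a) ≡ a
  signFlip-involutive x (y , b) with does (x ≟ˢ y)
  ... | true  = cong (y ,_) (not-involutive b)
  ... | false = refl

  signFlip-self : ∀ a → signFlip (proj₁ a) a ≡ invert a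
  signFlip-self (x , b) rewrite dec-true (x ≟ˢ x) refl = refl

  signFlip-reflects : ∀ x {a b} → Cancels (signFlip x a) (signFlip x b) → Cancels a b
  signFlip-reflects x {y , b₁} {.y , b₂} (refl , e) with does (x ≟ˢ y)
  ... | true  = refl , not-injective e
  ... | false = refl , e

  signFlip-preserves : ∀ x {a b} → Cancels a b → Cancels (signFlip x a) (signFlip x b)
  signFlip-preserves x {a} {b} c = signFlip-reflects x
    (subst₂ Cancels (sym (signFlip-involutive x a)) (sym (signFlip-involutive x b)) c)

  flipSigns : Seq2 n → Word n → Word n
  flipSigns x = map (signFlip x)

  flipSigns-involutive : ∀ x w → flipSigns x (flipSigns x w) ≡ w
  flipSigns-involutive x []      = refl
  flipSigns-involutive x (a ∷ w) = cong₂ _∷_ (signFlip-involutive x a) (flipSigns-involutive x w)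

  Reduced-flipSigns : ∀ x w → Reduced w → Reduced (flipSigns x w)
  Reduced-flipSigns x []          _        = tt
  Reduced-flipSigns x (a ∷ [])    _        = tt
  Reduced-flipSigns x (a ∷ b ∷ w) (¬c , r) = ¬c ∘ signFlip-reflects x , Reduced-flipSigns x (b ∷ w) r

  -- signFlip x is the automorphism of 𝔽(ⁿ2) inverting the generator x.
  push-flipSigns : ∀ x a w → push (signFlip x a) (flipSigns x w) ≡ flipSigns x (push a w)
  push-flipSigns x a []      = refl
  push-flipSigns x a (b ∷ w) with cancels? a b
  ... | yes c = push-cancels (flipSigns x w) (signFlip-preserves x c)
  ... | no ¬c = push-keeps (flipSigns x w) (¬c ∘ signFlip-reflects x)

  push-invert-flipSigns : ∀ a w →
                          push (invert a) (flipSigns (proj₁ a) w) ≡ flipSigns (proj₁ a) (push a w)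
  push-invert-flipSigns a w = subst (λ a′ → push a′ (flipSigns x w) ≡ flipSigns x (push a w))
                                    (signFlip-self a) (push-flipSigns x a w)
    where x = proj₁ a

module Ball (r : ℕ) {n : ℕ} where

  InBall : Pred (Word n) 0ℓ
  InBall w = Reduced w × length w ≤ r

  inBall? : Decidable InBall
  inBall? w = reduced? w ×-dec length w ≤? r

  ballAct : Letter n → Word n → Word n
  ballAct a w with length (push a w) ≤? r
  ... | yes _ = push a w
  ... | no _  = flipSigns (proj₁ a) w

  ballAct-push : ∀ a w → length (push a w) ≤ r → ballAct a w ≡ push a w
  ballAct-push a w inside with length (push a w) ≤? r
  ... | yes _       = refl
  ... | no  outside = contradiction inside outside

  ballAct-flip : ∀ a w → ¬ length (push a w) ≤ r → ballAct a w ≡ flipSigns (proj₁ a) w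
  ballAct-flip a w outside with length (push a w) ≤? r
  ... | yes inside = contradiction inside outside
  ... | no  _      = refl

  InBall-ballAct : ∀ a {w} → InBall w → InBall (ballAct a w)
  InBall-ballAct a {w} (red , len) with length (push a w) ≤? r
  ... | yes inside = Reduced-push a w red , inside
  ... | no  _      = Reduced-flipSigns (proj₁ a) w red ,
                     subst (_≤ r) (sym (length-map (signFlip (proj₁ a)) w)) len

  ballAct-inverse : ∀ a {w} → InBall w → ballAct (invert a) (ballAct a w) ≡ w
  ballAct-inverse a {w} (red , len) with length (push a w) ≤? r
  ... | yes _       = begin
    ballAct (invert a) (push a w) ≡⟨ ballAct-push (invert a) (push a w) inside′ ⟩
    push (invert a) (push a w)    ≡⟨ push-invert a w red ⟩
    w                             ∎
    where
    open ≡-Reasoning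
    inside′ : length (push (invert a) (push a w)) ≤ r
    inside′ rewrite push-invert a w red = len
  ... | no  outside = begin
    ballAct (invert a) (flipSigns x w) ≡⟨ ballAct-flip (invert a) (flipSigns x w) outside′ ⟩
    flipSigns x (flipSigns x w)        ≡⟨ flipSigns-involutive x w ⟩
    w                                  ∎
    where
    open ≡-Reasoning
    x = proj₁ a
    outside′ : ¬ length (push (invert a) (flipSigns x w)) ≤ r
    outside′ rewrite push-invert-flipSigns a w | length-map (signFlip x) (push a w) = outside

  ballAct-inverseʳ : ∀ a {w} → InBall w → ballAct a (ballAct (invert a) w) ≡ w
  ballAct-inverseʳ a {w} w∈B = subst (λ a′ → ballAct a′ (ballAct (invert a) w) ≡ w)
                                      (invert-involutive a) (ballAct-inverse (invert a) w∈B)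

  ballAct-reduced : ∀ a w → InBall (a ∷ w) → ballAct a w ≡ a ∷ w
  ballAct-reduced a w (red , len) = trans (ballAct-push a w len′) (push-reduced a w red)
    where len′ = subst (λ v → length v ≤ r) (sym (push-reduced a w red)) len

∷↔ : ∀ {A : Set} {k} → (A × Vec A k) ↔ Vec A (suc k)
∷↔ = mk↔ₛ′ (uncurry _∷_) uncons (λ { (x ∷ xs) → refl }) (λ _ → refl)

^↔Vec : ∀ {m} {A : Set} → Fin m ↔ A → ∀ k → Fin (m ^ k) ↔ Vec A k
^↔Vec e zero    = mk↔ₛ′ (const []) (const zero) (λ { [] → refl }) (λ { zero → refl })
^↔Vec e (suc k) = ∷↔ ↔-∘ ((e ×-↔ ^↔Vec e k) ↔-∘ *↔×)

module _ {A : Set} where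

  pad : ∀ k → List A → Vec (⊤ ⊎ A) k
  pad zero    _        = []
  pad (suc k) []       = inj₁ tt ∷ pad k []
  pad (suc k) (a ∷ as) = inj₂ a ∷ pad k as

  unpad : ∀ {k} → Vec (⊤ ⊎ A) k → List A
  unpad []            = []
  unpad (inj₁ _ ∷ _)  = []
  unpad (inj₂ a ∷ xs) = a ∷ unpad xs

  unpad-pad : ∀ {k} (as : List A) → length as ≤ k → unpad (pad k as) ≡ as
  unpad-pad {zero}  []       _         = refl
  unpad-pad {suc k} []       _         = refl
  unpad-pad {suc k} (a ∷ as) (s≤s len) = cong (a ∷_) (unpad-pad as len)

letter↔ : ∀ n → Fin (2 ^ n * 2) ↔ Letter n
letter↔ n = (^↔Vec 2↔Bool n ×-↔ 2↔Bool) ↔-∘ *↔×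

codeSize : ℕ → ℕ
codeSize n = suc (2 ^ n * 2) ^ n

paddedWord↔ : ∀ n → Fin (codeSize n) ↔ Vec (⊤ ⊎ Letter n) n
paddedWord↔ n = ^↔Vec ((1↔⊤ ⊎-↔ letter↔ n) ↔-∘ +↔⊎) n

module Extension {K : ℕ} {A : Set} {P : Pred A 0ℓ} (P? : Decidable P)
                 (encode : A → Fin K) (decode : Fin K → A)
                 (decode-encode : ∀ {a} → P a → decode (encode a) ≡ a) where

  IsCode : Pred (Fin K) 0ℓ
  IsCode i = P (decode i) × encode (decode i) ≡ i

  isCode? : Decidable IsCode
  isCode? i = P? (decode i) ×-dec (encode (decode i) ≟ i)

  extend : (A → A) → Fin K → Fin K
  extend f i with isCode? i
  ... | yes _ = encode (f (decode i))
  ... | no  _ = i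

  extend-encode : ∀ f {a} → P a → extend f (encode a) ≡ encode (f a)
  extend-encode f {a} pa with isCode? (encode a)
  ... | yes _     = cong (encode ∘ f) (decode-encode pa)
  ... | no  ¬code = contradiction (subst P (sym (decode-encode pa)) pa , cong encode (decode-encode pa)) ¬code

  extend-inverse : ∀ {f g} → (∀ {a} → P a → P (f a)) → (∀ {a} → P a → g (f a) ≡ a) →
                   ∀ i → extend g (extend f i) ≡ i
  extend-inverse {f} {g} f-closed gf i with isCode? i
  ... | yes (pa , code) = begin
    extend g (encode (f (decode i))) ≡⟨ extend-encode g (f-closed pa) ⟩
    encode (g (f (decode i)))        ≡⟨ cong encode (gf pa) ⟩
    encode (decode i)                ≡⟨ code ⟩
    i                                ∎
    where open ≡-Reasoning
  ... | no ¬code with isCode? i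
  ...   | yes code = contradiction code ¬code
  ...   | no  _    = refl

Sym : ℕ → Group 0ℓ 0ℓ
Sym K = record
  { Carrier = Permutation′ K
  ; _≈_ = λ π ρ → π ⟨$⟩ʳ_ ≗ ρ ⟨$⟩ʳ_
  ; _∙_ = _↔-∘_
  ; ε = ↔-id (Fin K)
  ; _⁻¹ = ↔-sym
  ; isGroup = record
    { isMonoid = record
      { isSemigroup = record
        { isMagma = record
          { isEquivalence = record
            { refl = λ _ → refl
            ; sym = λ π≈ρ i → sym (π≈ρ i)
            ; trans = λ π≈ρ ρ≈τ i → trans (π≈ρ i) (ρ≈τ i)
            }
          ; ∙-cong = λ {π} {_} {_} {σ′} π≈π′ σ≈σ′ i →
              trans (cong (π ⟨$⟩ʳ_) (σ≈σ′ i)) (π≈π′ (σ′ ⟨$⟩ʳ i))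
          }
        ; assoc = λ _ _ _ _ → refl
        }
      ; identity = (λ _ _ → refl) , (λ _ _ → refl)
      }
    ; inverse = (λ π _ → inverseˡ π) , (λ π _ → inverseʳ π)
    ; ⁻¹-cong = λ {π} {ρ} π≈ρ i →
        trans (sym (inverseˡ ρ)) (cong (ρ ⟨$⟩ˡ_) (trans (sym (π≈ρ (π ⟨$⟩ˡ i))) (inverseʳ π)))
    }
  }

allFunctions : ∀ {m n} → List (Fin m → Fin n)
allFunctions {m} {n} = map finToFun (allFin (n ^ m))

allFunctions-complete : ∀ {m n} (f : Fin m → Fin n) → Any (_≗ f) allFunctions
allFunctions-complete f = map⁺ (Any.map (λ { refl → finToFun-funToFin f }) (∈-allFin (funToFin f)))

module _ {K : ℕ} where

  permutationFrom : (Fin K → Fin K) → (Fin K → Fin K) → List (Permutation′ K)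
  permutationFrom f g with all? (λ i → f (g i) ≟ i) | all? (λ i → g (f i) ≟ i)
  ... | yes fg | yes gf = permutation f g fg gf ∷ []
  ... | _      | _      = []

  permutationFrom-complete : ∀ (π : Permutation′ K) {f g} → f ≗ (π ⟨$⟩ʳ_) → g ≗ (π ⟨$⟩ˡ_) →
                             Any (Group._≈_ (Sym K) π) (permutationFrom f g)
  permutationFrom-complete π {f} {g} f≗π g≗π⁻¹
    with all? (λ i → f (g i) ≟ i) | all? (λ i → g (f i) ≟ i)
  ... | yes _  | yes _  = here (λ i → sym (f≗π i))
  ... | no ¬fg | _      = contradiction (λ i → trans (cong f (g≗π⁻¹ i)) (trans (f≗π _) (inverseʳ π))) ¬fg
  ... | yes _  | no ¬gf = contradiction (λ i → trans (cong g (f≗π i)) (trans (g≗π⁻¹ _) (inverseˡ π))) ¬gf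

Sym-finite : ∀ K → IsFiniteGroup (Sym K)
Sym-finite K = concat (cartesianProductWith permutationFrom allFunctions allFunctions)
  , λ π → concat⁺ (cartesianProductWith⁺ permutationFrom (permutationFrom-complete π)
                     (allFunctions-complete (π ⟨$⟩ʳ_)) (allFunctions-complete (π ⟨$⟩ˡ_)))

transpose-sends : ∀ {K} (i j : Fin K) → transpose i j ⟨$⟩ʳ i ≡ j
transpose-sends i j rewrite dec-true (i ≟ i) refl = refl

module IntervalAction (m : ℕ → ℕ) (n K : ℕ) (m-suc : m (suc n) ≡ m n + K) where

  toFin : Interval m n → Fin K
  toFin (k , m≤k , k<m′) =
    fromℕ< (subst (k ∸ m n <_) (m+n∸m≡n (m n) K) (∸-monoˡ-< (subst (k <_) m-suc k<m′) m≤k))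

  fromFin : Fin K → Interval m n
  fromFin i = m n + toℕ i , m≤m+n (m n) (toℕ i) , subst (m n + toℕ i <_) (sym m-suc) (+-monoʳ-< (m n) (toℕ<n i))

  toFin-fromFin : ∀ i → toFin (fromFin i) ≡ i
  toFin-fromFin i = toℕ-injective (trans (toℕ-fromℕ< _) (m+n∸m≡n (m n) (toℕ i)))

  fromFin-toFin : ∀ x → EqI m n (fromFin (toFin x)) x
  fromFin-toFin (k , m≤k , _) = trans (cong (m n +_) (toℕ-fromℕ< _)) (m+[n∸m]≡n m≤k)

  σ : Permutation′ K → Interval m n → Interval m n
  σ π x = fromFin (π ⟨$⟩ʳ toFin x)

  σ-isAction : IsAction (Sym K) (Interval m n) (EqI m n) σ
  σ-isAction = record
    { act-cong   = λ x π≈ρ → cong (λ i → m n + toℕ i) (π≈ρ (toFin x))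
    ; act-ident  = fromFin-toFin
    ; act-comp   = λ π ρ x → cong (λ i → m n + toℕ (π ⟨$⟩ʳ i)) (sym (toFin-fromFin (ρ ⟨$⟩ʳ toFin x)))
    ; faithful   = λ π fixes i → toℕ-injective (+-cancelˡ-≡ (m n) _ _
        (trans (cong (λ j → m n + toℕ (π ⟨$⟩ʳ j)) (sym (toFin-fromFin i))) (fixes (fromFin i))))
    ; transitive = λ x y → transpose (toFin x) (toFin y) ,
        trans (cong (λ i → m n + toℕ i) (transpose-sends (toFin x) (toFin y))) (fromFin-toFin y)
    }

sumSizes-telescopes : ∀ m → m 0 ≡ 0 → (∀ j → m j ≤ m (suc j)) → ∀ n → sumSizes m n ≡ m n
sumSizes-telescopes m m0≡0 mono zero = sym m0≡0
sumSizes-telescopes m m0≡0 mono (suc n) = begin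
  sum (map (size m) (upTo (suc n)))          ≡⟨ cong (sum ∘ map (size m)) (applyUpTo-∷ʳ (λ j → j) n) ⟨
  sum (map (size m) (upTo n ∷ʳ n))           ≡⟨ cong sum (map-++ (size m) (upTo n) (n ∷ [])) ⟩
  sum (map (size m) (upTo n) ++ size m n ∷ []) ≡⟨ sum-++ (map (size m) (upTo n)) (size m n ∷ []) ⟩
  sumSizes m n + (size m n + 0)              ≡⟨ cong₂ _+_ (sumSizes-telescopes m m0≡0 mono n) (+-identityʳ _) ⟩
  m n + (m (suc n) ∸ m n)                    ≡⟨ m+[n∸m]≡n (mono n) ⟩
  m (suc n)                                  ∎
  where open ≡-Reasoning

module Construction (n p : ℕ) where

  open Ball n {n}

  -- The first p + 2 points are not codes, hence fixed by every letter; they make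
  -- |Iₙ| exceed mₙ + 1 once p = mₙ.
  K : ℕ
  K = suc (suc p) + codeSize n

  encode : Word n → Fin K
  encode w = suc (suc p) ↑ʳ Inverse.from (paddedWord↔ n) (pad n w)

  decode : Fin K → Word n
  decode i = [ const [] , unpad ∘ Inverse.to (paddedWord↔ n) ]′ (splitAt (suc (suc p)) i)

  decode-encode : ∀ {w} → InBall w → decode (encode w) ≡ w
  decode-encode {w} (_ , len)
    rewrite splitAt-↑ʳ (suc (suc p)) (codeSize n) (Inverse.from (paddedWord↔ n) (pad n w)) =
    trans (cong unpad (Inverse.strictlyInverseˡ (paddedWord↔ n) (pad n w))) (unpad-pad w len)

  open Extension inBall? encode decode decode-encode

  letterPerm : Letter n → Permutation′ K
  letterPerm a = permutation (extend (ballAct a)) (extend (ballAct (invert a)))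
    (extend-inverse (InBall-ballAct (invert a)) (ballAct-inverseʳ a))
    (extend-inverse (InBall-ballAct a) (ballAct-inverse a))

  open Group (Sym K) using (_∙_; _≈_; ε)
  open Evaluation (Sym K)

  letterPerm-invert : ∀ a → letterPerm a ∙ letterPerm (invert a) ≈ ε
  letterPerm-invert a = extend-inverse (InBall-ballAct (invert a)) (ballAct-inverseʳ a)

  wordPerm : Word n → Permutation′ K
  wordPerm = eval letterPerm letterPerm-invert

  wordPerm-isFreeGroupHom : IsFreeGroupHom n (Sym K) wordPerm
  wordPerm-isFreeGroupHom = eval-isFreeGroupHom letterPerm letterPerm-invert

  wordPerm-encode-[] : ∀ w → InBall w → wordPerm w ⟨$⟩ʳ encode [] ≡ encode w
  wordPerm-encode-[] []      _   = refl
  wordPerm-encode-[] (a ∷ w) a∷w∈B = begin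
    extend (ballAct a) (wordPerm w ⟨$⟩ʳ encode []) ≡⟨ cong (extend (ballAct a)) (wordPerm-encode-[] w w∈B) ⟩
    extend (ballAct a) (encode w)                  ≡⟨ extend-encode (ballAct a) w∈B ⟩
    encode (ballAct a w)                           ≡⟨ cong encode (ballAct-reduced a w a∷w∈B) ⟩
    encode (a ∷ w)                                 ∎
    where
    open ≡-Reasoning
    w∈B : InBall w
    w∈B = Reduced-tail w (proj₁ a∷w∈B) , ≤-trans (n≤1+n _) (proj₂ a∷w∈B)

  wordPerm-injective : InjectiveOnW n (Sym K) wordPerm
  wordPerm-injective u v u∈B v∈B same = begin
    u                                 ≡⟨ decode-encode u∈B ⟨
    decode (encode u)                 ≡⟨ cong decode (wordPerm-encode-[] u u∈B) ⟨
    decode (wordPerm u ⟨$⟩ʳ encode []) ≡⟨ cong decode (same (encode [])) ⟩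
    decode (wordPerm v ⟨$⟩ʳ encode []) ≡⟨ cong decode (wordPerm-encode-[] v v∈B) ⟩
    decode (encode v)                 ≡⟨ decode-encode v∈B ⟩
    v                                 ∎
    where open ≡-Reasoning

start : ℕ → ℕ
start zero    = 0
start (suc n) = start n + Construction.K n (start n)

size-start : ∀ n → size start n ≡ Construction.K n (start n)
size-start n = m+n∸m≡n (start n) _

sumSizes<size∸1 : ∀ n → sumSizes start n < size start n ∸ 1
sumSizes<size∸1 n rewrite sumSizes-telescopes start refl (λ j → m≤m+n (start j) _) n | size-start n =
  s≤s (m≤m+n (start n) (codeSize n))

proposition1p2 :
  Σ (ℕ → ℕ) λ m →
  Σ ((n : ℕ) → Group 0ℓ 0ℓ) λ G →
  Σ ((n : ℕ) → Word n → Group.Carrier (G n)) λ c →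
  Σ ((n : ℕ) → Group.Carrier (G n) → Interval m n → Interval m n) λ σ →
    StrictlyIncreasing m × (m 0 ≡ 0) ×
    ((n : ℕ) →
      IsFiniteGroup (G n) ×
      IsFreeGroupHom n (G n) (c n) ×
      IsAction (G n) (Interval m n) (EqI m n) (σ n) ×
      (sumSizes m n < size m n ∸ 1) ×
      InjectiveOnW n (G n) (c n))
proposition1p2 =
  start , (λ n → Sym (K n)) , (λ n → Construction.wordPerm n (start n)) ,
  (λ n → IntervalAction.σ start n (K n) refl) ,
  (λ n → m<m+n (start n) (s≤s z≤n)) , refl ,
  λ n → Sym-finite (K n)
      , Construction.wordPerm-isFreeGroupHom n (start n)
      , IntervalAction.σ-isAction start n (K n) refl
      , sumSizes<size∸1 n
      , Construction.wordPerm-injective n (start n)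
  where
  K : ℕ → ℕ
  K n = Construction.K n (start n)
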